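{- Let $\omega$ be a permutation, $k,m$ positive integers, and let $\mathcal T\in k_{(m)}\cdot\mathcal T_\omega$ have labels $(1,a_1,b_1),\ldots,(m,a_m,b_m)$ satisfying $a_1\ge a_2\ge\cdots\ge a_m$. Then $b_1,\ldots,b_m$ are pairwise distinct if and only if no two labelled cells of $\mathcal T$ lie in the same tower.
   Context: Permutations compose as functions; $t_{a,b}$ transposes $a,b$; $s_p=t_{p,p+1}$; $\ell$ is length. A tower diagram is a sequence $(\mathcal T_1,\mathcal T_2,\ldots)$ of nonnegative integers, almost all zero; the $p$-th tower consists of the cells $(p,0),\ldots,(p,\mathcal T_p-1)$. Sliding $i$ into $\mathcal T$: set $s:=i$, examine towers $p=1,2,\ldots$ with $h=\mathcal T_p$: if $s>p+h$ go on; if $s=p+h$ increase $\mathcal T_p$ by one and stop; if $h\ge1$ and $s=p+h-1$ decrease $\mathcal T_p$ by one and stop; if $s<p+h-1$ set $s:=s+1$ and go on. $\mathcal T_w$ is obtained by sliding a reduced word of $w$ letter by letter into the empty diagram. A saturated $k$-Bruhat chain of length $m$ from $\omega$: pairs $(a_q,b_q)$ with $a_q\le k<b_q$ and $\ell(\omega^{(q)})=\ell(\omega^{(q-1)})+1$, where $\omega^{(0)}=\omega$, $\omega^{(q)}=\omega^{(q-1)}t_{a_q,b_q}$. It is known that $\mathcal T_{\omega^{(q)}}$ is obtained from $D:=\mathcal T_{\omega^{(q-1)}}$ by raising tower $s=\omega^{(q-1)}(a_q)$ by $r+1$ cells and lowering tower $l=\omega^{(q-1)}(b_q)$ by $r$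 cells for some $r\ge0$, other towers unchanged. $k_{(m)}\cdot\mathcal T_\omega$ consists, for each chain, of $\mathcal T_{\omega^{(m)}}$ with labels $(q,a_q,b_q)$, attached to cells as follows: at step $q$ the label $(q,a_q,b_q)$ is attached to the cell $(s,D_s)$; earlier labelled cells keep their positions, except that a labelled cell among the removed cells $(l,D_l-r+u)$, $0\le u<r$, is carried to $(s,D_s+1+u)$. -}

module Defs where

open import Data.Nat using (ℕ; zero; suc; _+_; _∸_; _⊔_; _≤_; _<_; _≡ᵇ_; _<ᵇ_; _≤ᵇ_)
open import Data.Bool using (Bool; true; false; if_then_else_; _∧_)
open import Data.List using (List; []; _∷_; _++_; [_]; replicate; foldl; map; length; applyUpTo)
open import Data.Maybe using (Maybe; just; nothing)
open import Data.Product using (_×_; _,_; proj₁; proj₂)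
open import Data.Unit using (⊤)
open import Relation.Binary.PropositionalEquality using (_≡_)

-- Permutations of the positive integers with finite support, given in
-- one-line notation  w = [w(1), …, w(n)]  (and w(x) = x for x > n).

nthD : ℕ → List ℕ → ℕ → ℕ
nthD _       []       d = d
nthD zero    (x ∷ xs) d = x
nthD (suc j) (x ∷ xs) d = nthD j xs d

IsPerm : List ℕ → Set
IsPerm w = w ↭ applyUpTo suc (length w)
  where open import Data.List.Relation.Binary.Permutation.Propositional using (_↭_)

at : List ℕ → ℕ → ℕ
at w zero    = zero
at w (suc j) = nthD j w (suc j)

tr : ℕ → ℕ → ℕ → ℕ
tr a b x = if x ≡ᵇ a then b else (if x ≡ᵇ b then a else x)

mulT : List ℕ → ℕ → ℕ → List ℕ
mulT w a b = applyUpTo (λ i → at w (tr a b (suc i))) (length w ⊔ a ⊔ b)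

cntLess : ℕ → List ℕ → ℕ
cntLess x []       = 0
cntLess x (y ∷ ys) = (if y <ᵇ x then 1 else 0) + cntLess x ys

len : List ℕ → ℕ
len []       = 0
len (x ∷ xs) = cntLess x xs + len xs

-- A (canonical) reduced word:  if p is the first right descent of w
-- (w(p) > w(p+1)) then w = (w s_p) s_p with ℓ(w s_p) = ℓ(w) - 1, so a
-- reduced word of w is  (reduced word of w s_p) ++ [p].

firstDescent : ℕ → List ℕ → Maybe ℕ
firstDescent i (x ∷ y ∷ r) = if y <ᵇ x then just i else firstDescent (suc i) (y ∷ r)
firstDescent i _           = nothing

redWordF : ℕ → List ℕ → List ℕ
redWordF zero    w = []
redWordF (suc f) w with firstDescent 1 w
... | nothing = []
... | just p  = redWordF f (mulT w p (suc p)) ++ [ p ]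

redWord : List ℕ → List ℕ
redWord w = redWordF (len w) w

-- Tower diagrams: the list [T₁, T₂, …] (trailing towers are 0).

height : List ℕ → ℕ → ℕ
height T zero    = 0
height T (suc j) = nthD j T 0

-- sliding with current value s, examining towers p, p+1, … (the list
-- holds the towers from p on).
slide : ℕ → ℕ → List ℕ → List ℕ
slide s p [] = replicate (s ∸ p) 0 ++ [ 1 ]        -- all further towers are 0
slide s p (h ∷ hs) =
  if p + h <ᵇ s then h ∷ slide s (suc p) hs
  else if s ≡ᵇ p + h then suc h ∷ hs
  else if (1 ≤ᵇ h) ∧ (suc s ≡ᵇ p + h) then (h ∸ 1) ∷ hs
  else h ∷ slide (suc s) (suc p) hs                  -- s < p + h - 1

slideIn : List ℕ → ℕ → List ℕ
slideIn T i = slide i 1 T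

towersOfWord : List ℕ → List ℕ
towersOfWord = foldl slideIn []

towerDiagram : List ℕ → List ℕ
towerDiagram w = towersOfWord (redWord w)

KBruhatChain : ℕ → List ℕ → List (ℕ × ℕ) → Set
KBruhatChain k w [] = ⊤
KBruhatChain k w ((a , b) ∷ c) =
  (1 ≤ a) × (a ≤ k) × (k < b) × (len (mulT w a b) ≡ len w + 1)
  × KBruhatChain k (mulT w a b) c

-- Labelled cells: label (q , a_q , b_q) at cell (column , row).

Label : Set
Label = ℕ × ℕ × ℕ

Cell : Set
Cell = ℕ × ℕ

LCell : Set
LCell = Label × Cell

moveCell : List ℕ → ℕ → ℕ → ℕ → Cell → Cell
moveCell D s l r (x , y) =
  if (x ≡ᵇ l) ∧ ((height D l ∸ r) ≤ᵇ y) ∧ (y <ᵇ height D l)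
  then (s , height D s + 1 + (y ∸ (height D l ∸ r)))
  else (x , y)

buildLabels : ℕ → List ℕ → List LCell → List (ℕ × ℕ) → List ℕ × List LCell
buildLabels q w cells [] = w , cells
buildLabels q w cells ((a , b) ∷ c) =
  buildLabels (suc q) w' cells' c
  where
    D  = towerDiagram w
    s  = at w a
    l  = at w b
    w' = mulT w a b
    r  = height D l ∸ height (towerDiagram w') l
    cells' = map (λ lc → proj₁ lc , moveCell D s l r (proj₂ lc)) cells
             ++ [ ((q , a , b) , (s , height D s)) ]

-- the element of k_(m)·𝒯_ω determined by a chain:
-- (the diagram 𝒯_{ω^{(m)}} , its labelled cells)
labelledDiagram : List ℕ → List (ℕ × ℕ) → List ℕ × List LCell
labelledDiagram ω c with buildLabels 1 ω [] c
... | (w , cells) = towerDiagram w , cells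

-- Key invariant: once the chain has reached the permutation w, the cell labelled
-- (q , a_q , b_q) lies in tower w(b_q).  The towers of the labelled cells are then
-- the images of the b-values under the final, injective, permutation, so one list
-- has repetitions iff the other has.
--
-- Keeping the invariant requires that a labelled cell in the lowered tower w(b)
-- is among the r cells carried over, and this needs exact tower heights.
module Submission where

open import Defs
open import Data.Nat
open import Data.Nat.Properties
open import Data.Bool using (Bool; true; false; if_then_else_; _∧_; T)
open import Data.Bool.Properties using (∧-zeroʳ)
open import Data.Empty using (⊥; ⊥-elim)
open import Data.Unit using (tt)
open import Data.Product using (Σ; _×_; _,_; proj₁; proj₂)
open import Relation.Nullary using (¬_; yes; no)
open import Relation.Binary.Definitions using (tri<; tri≈; tri>)
open import Relation.Binary.PropositionalEquality hiding ([_]; J)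
open import Data.List using (List; []; _∷_; _++_; [_]; length; applyUpTo; map; replicate; foldl)
open import Data.List.Properties using (length-++; length-applyUpTo; foldl-++; map-++; ++-assoc; ++-identityʳ; map-∘; map-cong-local)
open import Data.List.Membership.Propositional using (_∈_)
open import Data.List.Membership.DecPropositional _≟_ using (_∈?_)
import Data.List.Membership.Propositional.Properties as Mem
open import Data.List.Relation.Unary.Any using (here; there)
open import Data.List.Relation.Unary.All using (All; []; _∷_)
import Data.List.Relation.Unary.All as All
import Data.List.Relation.Unary.All.Properties as All
open import Data.List.Relation.Unary.Unique.Propositional using (Unique)
open import Data.List.Relation.Unary.AllPairs using (_∷_)
import Data.List.Relation.Unary.Unique.Propositional.Properties as Unique
open import Data.List.Relation.Binary.Permutation.Propositional using (↭-sym; ↭⇒↭ₛ)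
import Data.List.Relation.Binary.Permutation.Propositional.Properties as Perm
import Data.List.Relation.Binary.Permutation.Setoid.Properties as PermₛProps
open import Data.List.Relation.Unary.Linked using (Linked; [-]; _∷_)
open import Data.Maybe using (just; nothing)
open import Function.Base using (_∘_)
open import Function.Bundles using (_⇔_; mk⇔)

<ᵇ-true : ∀ {m n} → m < n → (m <ᵇ n) ≡ true
<ᵇ-true {m} {n} p with m <ᵇ n | <⇒<ᵇ p
... | true | _ = refl

<ᵇ-false : ∀ {m n} → ¬ (m < n) → (m <ᵇ n) ≡ false
<ᵇ-false {m} {n} p with m <ᵇ n | <ᵇ⇒< m n
... | false | _ = refl
... | true  | f = ⊥-elim (p (f tt))

≡ᵇ-true : ∀ {m n} → m ≡ n → (m ≡ᵇ n) ≡ true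
≡ᵇ-true {m} {n} p with m ≡ᵇ n | ≡⇒≡ᵇ m n p
... | true | _ = refl

≡ᵇ-false : ∀ {m n} → ¬ (m ≡ n) → (m ≡ᵇ n) ≡ false
≡ᵇ-false {m} {n} p with m ≡ᵇ n | ≡ᵇ⇒≡ m n
... | false | _ = refl
... | true  | f = ⊥-elim (p (f tt))

≤ᵇ-true : ∀ {m n} → m ≤ n → (m ≤ᵇ n) ≡ true
≤ᵇ-true {m} {n} p with m ≤ᵇ n | ≤⇒≤ᵇ p
... | true | _ = refl

ind : Bool → ℕ
ind b = if b then 1 else 0

ind≤1 : ∀ b → ind b ≤ 1
ind≤1 true  = s≤s z≤n
ind≤1 false = z≤n

ind-∧ : ∀ c b b' d → ind b ≡ ind b' + ind d → ind (c ∧ b) ≡ ind (c ∧ b') + (if d then ind c else 0)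
ind-∧ false b     b'    true  _ = refl
ind-∧ false b     b'    false _ = refl
ind-∧ true  true  true  false _ = refl
ind-∧ true  true  false true  _ = refl
ind-∧ true  false false false _ = refl
ind-∧ true  true  true  true  ()
ind-∧ true  true  false false ()
ind-∧ true  false true  _     ()
ind-∧ true  false false true  ()

ind-trichotomy : ∀ (f : ℕ → ℕ) {x y} → (f x ≡ f y → x ≡ y) → x ≢ y →
  ind (f x <ᵇ f y) + ind (f y <ᵇ f x) ≡ 1
ind-trichotomy f {x} {y} inj ne with <-cmp (f x) (f y)
... | tri< a _ _ rewrite <ᵇ-true a | <ᵇ-false (<⇒≯ a) = refl
... | tri≈ _ e _ = ⊥-elim (ne (inj e))
... | tri> _ _ c rewrite <ᵇ-true c | <ᵇ-false (<⇒≯ c) = refl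

sum : (ℕ → ℕ) → ℕ → ℕ
sum f zero    = 0
sum f (suc n) = sum f n + f n

sum-cong : ∀ {f g} n → (∀ x → x < n → f x ≡ g x) → sum f n ≡ sum g n
sum-cong zero    h = refl
sum-cong (suc n) h = cong₂ _+_ (sum-cong n (λ x p → h x (m<n⇒m<1+n p))) (h n ≤-refl)

sum-mono : ∀ {f g} n → (∀ x → x < n → f x ≤ g x) → sum f n ≤ sum g n
sum-mono zero    h = z≤n
sum-mono (suc n) h = +-mono-≤ (sum-mono n (λ x p → h x (m<n⇒m<1+n p))) (h n ≤-refl)

sum-+ : ∀ f g n → sum (λ x → f x + g x) n ≡ sum f n + sum g n
sum-+ f g zero    = refl
sum-+ f g (suc n) = begin
  sum (λ x → f x + g x) n + (f n + g n) ≡⟨ cong (_+ (f n + g n)) (sum-+ f g n) ⟩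
  sum f n + sum g n + (f n + g n)       ≡⟨ +-assoc (sum f n) (sum g n) _ ⟩
  sum f n + (sum g n + (f n + g n))     ≡⟨ cong (sum f n +_) (+-comm (sum g n) _) ⟩
  sum f n + ((f n + g n) + sum g n)     ≡⟨ cong (sum f n +_) (+-assoc (f n) (g n) _) ⟩
  sum f n + (f n + (g n + sum g n))     ≡⟨ sym (+-assoc (sum f n) (f n) _) ⟩
  sum f n + f n + (g n + sum g n)       ≡⟨ cong (sum f n + f n +_) (+-comm (g n) _) ⟩
  sum f n + f n + (sum g n + g n)       ∎
  where open ≡-Reasoning

sum-zero : ∀ {f} n → (∀ x → x < n → f x ≡ 0) → sum f n ≡ 0
sum-zero zero    h = refl
sum-zero (suc n) h rewrite sum-zero n (λ x p → h x (m<n⇒m<1+n p)) | h n ≤-refl = refl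

sum-extend : ∀ {f} n N → n ≤ N → (∀ x → n ≤ x → f x ≡ 0) → sum f N ≡ sum f n
sum-extend {f} n N le h with m≤n⇒∃[o]m+o≡n le
... | k , refl = go k
  where
  go : ∀ k → sum f (n + k) ≡ sum f n
  go zero    rewrite +-identityʳ n = refl
  go (suc k) rewrite +-suc n k | go k | h (n + k) (m≤m+n n k) = +-identityʳ _

sum-mono-range : ∀ f a b → a ≤ b → sum f a ≤ sum f b
sum-mono-range f a b le with m≤n⇒∃[o]m+o≡n le
... | k , refl = go k
  where
  go : ∀ k → sum f a ≤ sum f (a + k)
  go zero    rewrite +-identityʳ a = ≤-refl
  go (suc k) rewrite +-suc a k = ≤-trans (go k) (m≤m+n _ _)

sum-below : ∀ p N → p ≤ N → sum (λ x → ind (x <ᵇ p)) N ≡ p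
sum-below p N le =
  trans (sum-extend p N le (λ x q → cong ind (<ᵇ-false (≤⇒≯ q)))) (go p ≤-refl)
  where
  go : ∀ m → m ≤ p → sum (λ x → ind (x <ᵇ p)) m ≡ m
  go zero    _   = refl
  go (suc m) le' rewrite go m (<⇒≤ le') | <ᵇ-true {m} {p} le' = +-comm m 1

sum-point : ∀ (h : ℕ → ℕ) c N → c < N → sum (λ x → if x ≡ᵇ c then h x else 0) N ≡ h c
sum-point h c N lt = trans (sum-extend (suc c) N lt vanish) (trans (cong (_+ (if c ≡ᵇ c then h c else 0)) below) last)
  where
  vanish : ∀ x → suc c ≤ x → (if x ≡ᵇ c then h x else 0) ≡ 0
  vanish x le rewrite ≡ᵇ-false {x} {c} (λ e → <-irrefl (sym e) le) = refl
  below : sum (λ x → if x ≡ᵇ c then h x else 0) c ≡ 0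
  below = sum-zero c (λ x x<c → cong (λ b → if b then h x else 0) (≡ᵇ-false {x} {c} (λ e → <-irrefl e x<c)))
  last : 0 + (if c ≡ᵇ c then h c else 0) ≡ h c
  last rewrite ≡ᵇ-true {c} refl = refl

sum-prefix : ∀ f y N → y ≤ N → sum (λ x → if x <ᵇ y then f x else 0) N ≡ sum f y
sum-prefix f y N le = trans (sum-extend y N le vanish)
  (sum-cong y (λ x lt → cong (λ b → if b then f x else 0) (<ᵇ-true lt)))
  where
  vanish : ∀ x → y ≤ x → (if x <ᵇ y then f x else 0) ≡ 0
  vanish x le' rewrite <ᵇ-false {x} {y} (≤⇒≯ le') = refl

nthD-beyond : ∀ j (w : List ℕ) d → length w ≤ j → nthD j w d ≡ d
nthD-beyond j       []      d _         = refl
nthD-beyond (suc j) (x ∷ w) d (s≤s le) = nthD-beyond j w d le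

nthD-default : ∀ j (w : List ℕ) d d' → j < length w → nthD j w d ≡ nthD j w d'
nthD-default zero    (x ∷ w) d d' _        = refl
nthD-default (suc j) (x ∷ w) d d' (s≤s lt) = nthD-default j w d d' lt

nthD-applyUpTo : ∀ (f : ℕ → ℕ) N j d → nthD j (applyUpTo f N) d ≡ (if j <ᵇ N then f j else d)
nthD-applyUpTo f zero    j       d = refl
nthD-applyUpTo f (suc N) zero    d = refl
nthD-applyUpTo f (suc N) (suc j) d = nthD-applyUpTo (λ i → f (suc i)) N j d

nthD-∈ : ∀ j w d → j < length w → nthD j w d ∈ w
nthD-∈ zero    (x ∷ w) d _        = here refl
nthD-∈ (suc j) (x ∷ w) d (s≤s lt) = there (nthD-∈ j w d lt)

at-beyond : ∀ w x → length w < x → at w x ≡ x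
at-beyond w (suc j) (s≤s le) = nthD-beyond j w (suc j) le

at-nthD : ∀ w j → j < length w → at w (suc j) ≡ nthD j w 0
at-nthD w j lt = nthD-default j w (suc j) 0 lt

tr-a : ∀ a b → tr a b a ≡ b
tr-a a b rewrite ≡ᵇ-true {a} {a} refl = refl

tr-b : ∀ a b → tr a b b ≡ a
tr-b a b with b ≡ᵇ a in e
... | true  = ≡ᵇ⇒≡ b a (subst T (sym e) tt)
... | false rewrite ≡ᵇ-true {b} {b} refl = refl

tr-other : ∀ a b x → x ≢ a → x ≢ b → tr a b x ≡ x
tr-other a b x p q rewrite ≡ᵇ-false p | ≡ᵇ-false q = refl

tr-involutive : ∀ a b x → tr a b (tr a b x) ≡ x
tr-involutive a b x with x ≟ a
... | yes refl rewrite tr-a x b = tr-b x b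
... | no x≢a with x ≟ b
...   | yes refl rewrite tr-b a x = tr-a a x
...   | no x≢b rewrite tr-other a b x x≢a x≢b = tr-other a b x x≢a x≢b

at-mulT : ∀ w a b → 1 ≤ a → 1 ≤ b → ∀ y → at (mulT w a b) y ≡ at w (tr a b y)
at-mulT w a b ha hb zero rewrite tr-other a b 0 (λ e → <-irrefl e ha) (λ e → <-irrefl e hb) = refl
at-mulT w a b ha hb (suc j)
  rewrite nthD-applyUpTo (λ i → at w (tr a b (suc i))) (length w ⊔ a ⊔ b) j (suc j)
  with j <ᵇ (length w ⊔ a ⊔ b) in e
... | true  = refl
... | false = sym (trans (cong (at w) (tr-other a b (suc j) (outside (≤-trans (m≤n⊔m (length w) a) (m≤m⊔n _ b)))
                                                           (outside (m≤n⊔m (length w ⊔ a) b))))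
                         (at-beyond w (suc j) (s≤s (≤-trans (≤-trans (m≤m⊔n (length w) a) (m≤m⊔n _ b)) ge))))
  where
  ge : length w ⊔ a ⊔ b ≤ j
  ge = ≮⇒≥ (λ lt → subst T e (<⇒<ᵇ lt))
  outside : ∀ {c} → c ≤ length w ⊔ a ⊔ b → suc j ≢ c
  outside le refl = <-irrefl refl (≤-trans (s≤s le) (s≤s ge))

Bijective : List ℕ → Set
Bijective w = Σ (ℕ → ℕ) λ g → (∀ x → g (at w x) ≡ x) × (∀ y → at w (g y) ≡ y)

bij-injective : ∀ {w} → Bijective w → ∀ {x y} → at w x ≡ at w y → x ≡ y
bij-injective (g , l , r) {x} {y} e = trans (sym (l x)) (trans (cong g e) (l y))

bij-mulT : ∀ {w} a b → 1 ≤ a → 1 ≤ b → Bijective w → Bijective (mulT w a b)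
bij-mulT {w} a b ha hb (g , l , r) =
  (λ y → tr a b (g y)) ,
  (λ x → trans (cong (λ z → tr a b (g z)) (at-mulT w a b ha hb x))
               (trans (cong (tr a b) (l (tr a b x))) (tr-involutive a b x))) ,
  (λ y → trans (at-mulT w a b ha hb (tr a b (g y))) (trans (cong (at w) (tr-involutive a b (g y))) (r y)))

bij-range : ∀ {w} → Bijective w → ∀ x → x ≤ length w → at w x ≤ length w
bij-range {w} B x le with at w x ≤? length w
... | yes p = p
... | no p  = ⊥-elim (<-irrefl refl (≤-trans (s≤s (subst (_≤ length w) (sym fixed) le)) (≰⇒> p)))
  where
  fixed : at w x ≡ x
  fixed = bij-injective B (at-beyond w (at w x) (≰⇒> p))

bij-positive : ∀ {w} → Bijective w → ∀ y → 1 ≤ y → 1 ≤ at w y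
bij-positive {w} B (suc y) _ with at w (suc y) in e
... | zero  = ⊥-elim (<-irrefl (sym (bij-injective B {suc y} {0} e)) (s≤s z≤n))
... | suc _ = s≤s z≤n

index : ℕ → List ℕ → ℕ
index q []       = 0
index q (x ∷ xs) = if x ≡ᵇ q then 0 else suc (index q xs)

index-∈ : ∀ q w d → q ∈ w → index q w < length w × nthD (index q w) w d ≡ q
index-∈ q (x ∷ xs) d m with x ≟ q
... | yes e rewrite ≡ᵇ-true e = s≤s z≤n , e
... | no ne rewrite ≡ᵇ-false ne with m
...   | here e   = ⊥-elim (ne (sym e))
...   | there m' = let (lt , e) = index-∈ q xs d m' in s≤s lt , e

index-∉ : ∀ q w → ¬ (q ∈ w) → index q w ≡ length w
index-∉ q []       _  = refl
index-∉ q (x ∷ xs) nm with x ≟ q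
... | yes e  = ⊥-elim (nm (here (sym e)))
... | no ne rewrite ≡ᵇ-false ne = cong suc (index-∉ q xs (λ m → nm (there m)))

index-nthD : ∀ j w d → Unique w → j < length w → index (nthD j w d) w ≡ j
index-nthD zero    (x ∷ w) d u         lt rewrite ≡ᵇ-true {x} {x} refl = refl
index-nthD (suc j) (x ∷ w) d (x∉ ∷ u) (s≤s lt)
  rewrite ≡ᵇ-false {x} {nthD j w d} (All.lookup x∉ (nthD-∈ j w d lt)) = cong suc (index-nthD j w d u lt)

-- A one-line notation of a permutation of 1..n defines a bijection of ℕ;
-- the inverse sends q to 1 + (its position), or to q itself if q ∉ w.
isPerm-bijective : ∀ w → IsPerm w → Bijective w
isPerm-bijective w p = inv , inv-at , at-inv
  where
  n = length w
  ∈⇒range : ∀ {q} → q ∈ w → 1 ≤ q × q ≤ n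
  ∈⇒range m with Mem.∈-applyUpTo⁻ suc (Perm.Any-resp-↭ p m)
  ... | i , lt , refl = s≤s z≤n , lt
  range⇒∈ : ∀ {q} → 1 ≤ q → q ≤ n → q ∈ w
  range⇒∈ {suc q} _ le = Perm.Any-resp-↭ (↭-sym p) (Mem.∈-applyUpTo⁺ suc le)
  unique : Unique w
  unique = PermₛProps.Unique-resp-↭ (setoid ℕ) (↭⇒↭ₛ (↭-sym p))
             (Unique.applyUpTo⁺₁ suc n (λ lt _ e → <-irrefl (suc-injective e) lt))
  inv : ℕ → ℕ
  inv q = if index q w <ᵇ n then suc (index q w) else q
  inv-∈ : ∀ q → q ∈ w → inv q ≡ suc (index q w)
  inv-∈ q m rewrite <ᵇ-true (proj₁ (index-∈ q w 0 m)) = refl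
  inv-∉ : ∀ q → ¬ (q ∈ w) → inv q ≡ q
  inv-∉ q m rewrite index-∉ q w m | <ᵇ-false {n} {n} (<-irrefl refl) = refl
  at-inv : ∀ q → at w (inv q) ≡ q
  at-inv q with q ∈? w
  ... | yes m rewrite inv-∈ q m = proj₂ (index-∈ q w (suc (index q w)) m)
  ... | no m rewrite inv-∉ q m with q
  ...   | zero = refl
  ...   | suc q' with suc q' ≤? n
  ...     | yes le = ⊥-elim (m (range⇒∈ (s≤s z≤n) le))
  ...     | no gt  = at-beyond w (suc q') (≰⇒> gt)
  inv-at : ∀ x → inv (at w x) ≡ x
  inv-at zero = inv-∉ 0 (λ m → <-irrefl refl (proj₁ (∈⇒range m)))
  inv-at (suc j) with j <? n
  ... | yes lt = trans (inv-∈ _ (nthD-∈ j w (suc j) lt)) (cong suc (index-nthD j w (suc j) unique lt))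
  ... | no ge rewrite at-beyond w (suc j) (s≤s (≮⇒≥ ge)) =
        inv-∉ (suc j) (λ m → <-irrefl refl (≤-trans (s≤s (proj₂ (∈⇒range m))) (s≤s (≮⇒≥ ge))))

cntLess-++ : ∀ z xs ys → cntLess z (xs ++ ys) ≡ cntLess z xs + cntLess z ys
cntLess-++ z []       ys = refl
cntLess-++ z (x ∷ xs) ys rewrite cntLess-++ z xs ys = sym (+-assoc (ind (x <ᵇ z)) (cntLess z xs) (cntLess z ys))

<ᵇ-monoʳ : ∀ y {x x'} → x ≤ x' → ind (y <ᵇ x) ≤ ind (y <ᵇ x')
<ᵇ-monoʳ y {x} le with y <? x
... | yes p rewrite <ᵇ-true p | <ᵇ-true (<-≤-trans p le) = ≤-refl
... | no p  rewrite <ᵇ-false p = z≤n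

<ᵇ-antiˡ : ∀ m {y x} → y < x → ind (x <ᵇ m) ≤ ind (y <ᵇ m)
<ᵇ-antiˡ m {y} {x} lt with x <? m
... | yes p rewrite <ᵇ-true p | <ᵇ-true (<-trans lt p) = ≤-refl
... | no p  rewrite <ᵇ-false p = z≤n

cntLess-mono : ∀ L {x x'} → x ≤ x' → cntLess x L ≤ cntLess x' L
cntLess-mono []      le = z≤n
cntLess-mono (y ∷ L) le = +-mono-≤ (<ᵇ-monoʳ y le) (cntLess-mono L le)

cntLess-lower : ∀ m ms ys {x y} → y < x → cntLess m (ms ++ x ∷ ys) ≤ cntLess m (ms ++ y ∷ ys)
cntLess-lower m ms ys {x} {y} lt rewrite cntLess-++ m ms (x ∷ ys) | cntLess-++ m ms (y ∷ ys) =
  +-monoʳ-≤ (cntLess m ms) (+-monoˡ-≤ (cntLess m ys) (<ᵇ-antiˡ m lt))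

len-lower : ∀ ms ys {x y} → y < x → len (ms ++ x ∷ ys) + cntLess y ys ≤ len (ms ++ y ∷ ys) + cntLess x ys
len-lower [] ys {x} {y} lt = ≤-reflexive (begin
    cntLess x ys + len ys + cntLess y ys   ≡⟨ +-assoc (cntLess x ys) _ _ ⟩
    cntLess x ys + (len ys + cntLess y ys) ≡⟨ +-comm (cntLess x ys) _ ⟩
    len ys + cntLess y ys + cntLess x ys   ≡⟨ cong (_+ cntLess x ys) (+-comm (len ys) _) ⟩
    cntLess y ys + len ys + cntLess x ys   ∎)
  where open ≡-Reasoning
len-lower (m ∷ ms) ys {x} {y} lt = begin
    cntLess m (ms ++ x ∷ ys) + len (ms ++ x ∷ ys) + cntLess y ys
      ≡⟨ +-assoc (cntLess m (ms ++ x ∷ ys)) _ _ ⟩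
    cntLess m (ms ++ x ∷ ys) + (len (ms ++ x ∷ ys) + cntLess y ys)
      ≤⟨ +-mono-≤ (cntLess-lower m ms ys lt) (len-lower ms ys lt) ⟩
    cntLess m (ms ++ y ∷ ys) + (len (ms ++ y ∷ ys) + cntLess x ys)
      ≡⟨ sym (+-assoc (cntLess m (ms ++ y ∷ ys)) _ _) ⟩
    cntLess m (ms ++ y ∷ ys) + len (ms ++ y ∷ ys) + cntLess x ys ∎
  where open ≤-Reasoning

len-swap-head : ∀ ms ys {x y} → y < x → len (y ∷ ms ++ x ∷ ys) < len (x ∷ ms ++ y ∷ ys)
len-swap-head ms ys {x} {y} lt
  rewrite cntLess-++ y ms (x ∷ ys) | cntLess-++ x ms (y ∷ ys) | <ᵇ-false {x} {y} (<⇒≯ lt) | <ᵇ-true lt = begin-strict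
    cntLess y ms + cntLess y ys + len (ms ++ x ∷ ys)
      ≡⟨ +-assoc (cntLess y ms) _ _ ⟩
    cntLess y ms + (cntLess y ys + len (ms ++ x ∷ ys))
      ≡⟨ cong (cntLess y ms +_) (+-comm (cntLess y ys) _) ⟩
    cntLess y ms + (len (ms ++ x ∷ ys) + cntLess y ys)
      ≤⟨ +-mono-≤ (cntLess-mono ms (<⇒≤ lt)) (len-lower ms ys lt) ⟩
    cntLess x ms + (len (ms ++ y ∷ ys) + cntLess x ys)
      <⟨ +-monoʳ-< (cntLess x ms) (n<1+n _) ⟩
    cntLess x ms + suc (len (ms ++ y ∷ ys) + cntLess x ys)
      ≡⟨ cong (λ z → cntLess x ms + suc z) (+-comm (len (ms ++ y ∷ ys)) _) ⟩
    cntLess x ms + suc (cntLess x ys + len (ms ++ y ∷ ys))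
      ≡⟨ sym (+-assoc (cntLess x ms) (suc (cntLess x ys)) _) ⟩
    cntLess x ms + suc (cntLess x ys) + len (ms ++ y ∷ ys) ∎
  where open ≤-Reasoning

cntLess-exchange : ∀ z ms ys x y → cntLess z (y ∷ ms ++ x ∷ ys) ≡ cntLess z (x ∷ ms ++ y ∷ ys)
cntLess-exchange z ms ys x y rewrite cntLess-++ z ms (x ∷ ys) | cntLess-++ z ms (y ∷ ys) =
  begin
    Y + (M + (X + R)) ≡⟨ cong (Y +_) (sym (+-assoc M X R)) ⟩
    Y + (M + X + R)   ≡⟨ cong (λ t → Y + (t + R)) (+-comm M X) ⟩
    Y + (X + M + R)   ≡⟨ cong (Y +_) (+-assoc X M R) ⟩
    Y + (X + (M + R)) ≡⟨ sym (+-assoc Y X _) ⟩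
    Y + X + (M + R)   ≡⟨ cong (_+ (M + R)) (+-comm Y X) ⟩
    X + Y + (M + R)   ≡⟨ +-assoc X Y _ ⟩
    X + (Y + (M + R)) ≡⟨ cong (X +_) (sym (+-assoc Y M R)) ⟩
    X + (Y + M + R)   ≡⟨ cong (λ t → X + (t + R)) (+-comm Y M) ⟩
    X + (M + Y + R)   ≡⟨ cong (X +_) (+-assoc M Y R) ⟩
    X + (M + (Y + R)) ∎
  where
  open ≡-Reasoning
  X = ind (x <ᵇ z)
  Y = ind (y <ᵇ z)
  M = cntLess z ms
  R = cntLess z ys

len-exchange : ∀ xs ms ys {x y} → y < x → len (xs ++ y ∷ ms ++ x ∷ ys) < len (xs ++ x ∷ ms ++ y ∷ ys)
len-exchange []       ms ys lt = len-swap-head ms ys lt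
len-exchange (z ∷ xs) ms ys {x} {y} lt
  rewrite cntLess-++ z xs (y ∷ ms ++ x ∷ ys) | cntLess-++ z xs (x ∷ ms ++ y ∷ ys) | cntLess-exchange z ms ys x y =
  +-monoʳ-< _ (len-exchange xs ms ys lt)

-- Positions in lists are 0-based, so the
-- exchange of list positions i₁ < i₂ is the permutation  tr i₁ i₂  of indices.

tr-suc : ∀ a b z → tr (suc a) (suc b) (suc z) ≡ suc (tr a b z)
tr-suc a b z with z ≡ᵇ a
... | true  = refl
... | false with z ≡ᵇ b
...   | true  = refl
...   | false = refl

nthD-middle : ∀ (xs : List ℕ) x R d → nthD (length xs) (xs ++ x ∷ R) d ≡ x
nthD-middle []       x R d = refl
nthD-middle (z ∷ xs) x R d = nthD-middle xs x R d

nthD-replace : ∀ (ms : List ℕ) ys x y j d → j ≢ length ms → nthD j (ms ++ x ∷ ys) d ≡ nthD j (ms ++ y ∷ ys) d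
nthD-replace []       ys x y zero    d ne = ⊥-elim (ne refl)
nthD-replace []       ys x y (suc j) d ne = refl
nthD-replace (m ∷ ms) ys x y zero    d ne = refl
nthD-replace (m ∷ ms) ys x y (suc j) d ne = nthD-replace ms ys x y j d (λ e → ne (cong suc e))

nthD-exchange : ∀ xs ms ys x y j d →
  nthD j (xs ++ y ∷ ms ++ x ∷ ys) d ≡
  nthD (tr (length xs) (suc (length xs + length ms)) j) (xs ++ x ∷ ms ++ y ∷ ys) d
nthD-exchange (z ∷ xs) ms ys x y zero    d = refl
nthD-exchange (z ∷ xs) ms ys x y (suc j) d
  rewrite tr-suc (length xs) (suc (length xs + length ms)) j = nthD-exchange xs ms ys x y j d
nthD-exchange [] ms ys x y zero    d = sym (nthD-middle ms y ys d)
nthD-exchange [] ms ys x y (suc j) d with j ≟ length ms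
... | yes refl rewrite ≡ᵇ-true {length ms} refl = nthD-middle ms x ys d
... | no ne    rewrite ≡ᵇ-false ne = nthD-replace ms ys x y j d ne

nthD-second : ∀ xs ms ys x y d → nthD (suc (length xs + length ms)) (xs ++ x ∷ ms ++ y ∷ ys) d ≡ y
nthD-second xs ms ys x y d = begin
  nthD i₂ (xs ++ x ∷ ms ++ y ∷ ys) d                 ≡⟨ cong (λ i → nthD i (xs ++ x ∷ ms ++ y ∷ ys) d) (sym (tr-a (length xs) i₂)) ⟩
  nthD (tr (length xs) i₂ (length xs)) (xs ++ x ∷ ms ++ y ∷ ys) d ≡⟨ sym (nthD-exchange xs ms ys x y (length xs) d) ⟩
  nthD (length xs) (xs ++ y ∷ ms ++ x ∷ ys) d        ≡⟨ nthD-middle xs y (ms ++ x ∷ ys) d ⟩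
  y                                                  ∎
  where
  open ≡-Reasoning
  i₂ = suc (length xs + length ms)

length-cut : ∀ xs ms ys (x y : ℕ) → length (xs ++ x ∷ ms ++ y ∷ ys) ≡ suc (suc (length xs + length ms + length ys))
length-cut xs ms ys x y rewrite length-++ xs {x ∷ ms ++ y ∷ ys} | length-++ ms {y ∷ ys}
  | +-suc (length xs) (length ms + suc (length ys)) | +-suc (length ms) (length ys)
  | +-suc (length xs) (length ms + length ys) | +-assoc (length xs) (length ms) (length ys) = refl

list-ext : ∀ (L L' : List ℕ) → length L ≡ length L' →
  (∀ j → j < length L → nthD j L 0 ≡ nthD j L' 0) → L ≡ L'
list-ext []      []       _ _ = refl
list-ext (x ∷ L) (x' ∷ L') e h =
  cong₂ _∷_ (h 0 (s≤s z≤n)) (list-ext L L' (suc-injective e) (λ j lt → h (suc j) (s≤s lt)))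

split-at : ∀ j (w : List ℕ) → j < length w →
  Σ (List ℕ) λ xs → Σ ℕ λ z → Σ (List ℕ) λ zs → (w ≡ xs ++ z ∷ zs) × (length xs ≡ j)
split-at zero    (x ∷ w) _ = [] , x , w , refl , refl
split-at (suc j) (x ∷ w) (s≤s lt) with split-at j w lt
... | xs , z , zs , refl , refl = x ∷ xs , z , zs , refl , refl

Cut : List ℕ → ℕ → ℕ → Set
Cut w i₁ i₂ = Σ (List ℕ) λ xs → Σ (List ℕ) λ ms → Σ (List ℕ) λ ys → Σ ℕ λ x → Σ ℕ λ y →
  (w ≡ xs ++ x ∷ ms ++ y ∷ ys) × (length xs ≡ i₁) × (suc (length xs + length ms) ≡ i₂)

cut : ∀ w i₁ i₂ → i₁ < i₂ → i₂ < length w → Cut w i₁ i₂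
cut w i₁ i₂ i₁<i₂ i₂<n with m≤n⇒∃[o]m+o≡n i₁<i₂
... | d , refl with split-at i₁ w (<-trans (n<1+n i₁) (≤-trans (s≤s (m≤m+n (suc i₁) d)) i₂<n))
...   | xs , x , r , refl , refl with split-at d r (+-cancelˡ-< (suc (length xs)) d (length r) d<r)
  where
  d<r : suc (length xs) + d < suc (length xs) + length r
  d<r = subst (suc (length xs) + d <_) (trans (length-++ xs) (+-suc (length xs) (length r))) i₂<n
...     | ms , y , ys , refl , refl = xs , ms , ys , x , y , refl , refl , refl

mulT-exchange : ∀ xs ms ys x y → let W = xs ++ x ∷ ms ++ y ∷ ys in
  mulT W (suc (length xs)) (suc (suc (length xs + length ms))) ≡ xs ++ y ∷ ms ++ x ∷ ys
mulT-exchange xs ms ys x y =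
  list-ext (mulT W a b) W' (trans length-mulT (sym length-W')) entry
  where
  W = xs ++ x ∷ ms ++ y ∷ ys
  W' = xs ++ y ∷ ms ++ x ∷ ys
  i₁ = length xs
  i₂ = suc (length xs + length ms)
  a = suc i₁
  b = suc i₂
  i₂<n : i₂ < length W
  i₂<n = ≤-trans (s≤s (s≤s (m≤m+n _ (length ys)))) (≤-reflexive (sym (length-cut xs ms ys x y)))
  length-mulT : length (mulT W a b) ≡ length W
  length-mulT = trans (length-applyUpTo _ _)
    (trans (cong (_⊔ b) (m≥n⇒m⊔n≡m (≤-trans (s≤s (m≤m+n i₁ _)) (≤-trans (n≤1+n _) i₂<n)))) (m≥n⇒m⊔n≡m i₂<n))
  length-W' : length W' ≡ length W
  length-W' = trans (length-cut xs ms ys y x) (sym (length-cut xs ms ys x y))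
  tr-range : ∀ j → j < length W → tr i₁ i₂ j < length W
  tr-range j lt with j ≟ i₁
  ... | yes refl rewrite tr-a j i₂ = i₂<n
  ... | no ne with j ≟ i₂
  ...   | yes refl rewrite tr-b i₁ j = <-trans (s≤s (m≤m+n i₁ _)) i₂<n
  ...   | no ne' rewrite tr-other i₁ i₂ j ne ne' = lt
  entry : ∀ j → j < length (mulT W a b) → nthD j (mulT W a b) 0 ≡ nthD j W' 0
  entry j lt = begin
    nthD j (mulT W a b) 0
      ≡⟨ nthD-applyUpTo (λ i → at W (tr a b (suc i))) (length W ⊔ a ⊔ b) j 0 ⟩
    (if j <ᵇ (length W ⊔ a ⊔ b) then at W (tr a b (suc j)) else 0)
      ≡⟨ cong (λ c → if c then at W (tr a b (suc j)) else 0) (<ᵇ-true (subst (j <_) (length-applyUpTo (λ i → at W (tr a b (suc i))) (length W ⊔ a ⊔ b)) lt)) ⟩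
    at W (tr a b (suc j))          ≡⟨ cong (at W) (tr-suc i₁ i₂ j) ⟩
    at W (suc (tr i₁ i₂ j))        ≡⟨ at-nthD W (tr i₁ i₂ j) (tr-range j (subst (j <_) length-mulT lt)) ⟩
    nthD (tr i₁ i₂ j) W 0          ≡⟨ sym (nthD-exchange xs ms ys x y j 0) ⟩
    nthD j W' 0                    ∎
    where open ≡-Reasoning

mulT-inversion-len : ∀ w a b → 1 ≤ a → a < b → b ≤ length w → at w b < at w a → len (mulT w a b) < len w
mulT-inversion-len w (suc i₁) (suc i₂) _ (s≤s i₁<i₂) i₂<n lt with cut w i₁ i₂ i₁<i₂ i₂<n
... | xs , ms , ys , x , y , refl , refl , refl
  rewrite mulT-exchange xs ms ys x y
        | at-nthD (xs ++ x ∷ ms ++ y ∷ ys) (length xs) (<-trans (s≤s (m≤m+n _ _)) i₂<n)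
        | at-nthD (xs ++ x ∷ ms ++ y ∷ ys) (suc (length xs + length ms)) i₂<n
        | nthD-middle xs x (ms ++ y ∷ ys) 0 | nthD-second xs ms ys x y 0
  = len-exchange xs ms ys lt

bruhat-ascent : ∀ {w} a b → Bijective w → 1 ≤ a → a < b → len (mulT w a b) ≡ len w + 1 → at w a < at w b
bruhat-ascent {w} a b B ha a<b up with b ≤? length w
... | yes b≤n with <-cmp (at w a) (at w b)
...   | tri< p _ _ = p
...   | tri≈ _ p _ = ⊥-elim (<-irrefl (bij-injective B p) a<b)
...   | tri> _ _ p = ⊥-elim (<-asym (mulT-inversion-len w a b ha a<b b≤n p) longer)
  where
  longer : len w < len (mulT w a b)
  longer = subst (len w <_) (trans (+-comm 1 (len w)) (sym up)) (n<1+n (len w))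
bruhat-ascent {w} a b B ha a<b up | no b>n rewrite at-beyond w b (≰⇒> b>n) with a ≤? length w
... | yes a≤n = ≤-trans (s≤s (bij-range B a a≤n)) (≰⇒> b>n)
... | no a>n rewrite at-beyond w a (≰⇒> a>n) = a<b

-- Sliding a value into a tower diagram, analysed through a "trajectory" σ:
-- σ q is the value carried when tower q is examined.  If at every tower q < t
-- the slide passes by (σ unchanged) or passes while incrementing, and at tower t
-- the value equals t + H t, then the slide raises tower t by one and nothing else.
-- The list T is read as the towers p0, p0+1, …, so tower q is entry q ∸ p0.

hgt : List ℕ → ℕ → ℕ → ℕ
hgt T p0 q = nthD (q ∸ p0) T 0

hgt-head : ∀ h hs p0 → hgt (h ∷ hs) p0 p0 ≡ h
hgt-head h hs p0 rewrite n∸n≡0 p0 = refl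

hgt-tail : ∀ x L p0 q → p0 < q → hgt (x ∷ L) p0 q ≡ hgt L (suc p0) q
hgt-tail x L p0 (suc q) (s≤s p0≤q) rewrite +-∸-assoc 1 p0≤q = refl

data SlideStep (H σ : ℕ → ℕ) (q : ℕ) : Set where
  passes      : q + H q < σ q → σ (suc q) ≡ σ q → SlideStep H σ q
  increments  : suc (σ q) < q + H q → σ (suc q) ≡ suc (σ q) → SlideStep H σ q

slide-passes : ∀ {H σ} s p0 h hs → SlideStep H σ p0 → σ p0 ≡ s → H p0 ≡ h →
  slide s p0 (h ∷ hs) ≡ h ∷ slide (σ (suc p0)) (suc p0) hs
slide-passes {H} {σ} s p0 h hs (passes past next) refl refl rewrite <ᵇ-true past | next = refl
slide-passes {H} {σ} s p0 h hs (increments short next) refl refl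
  rewrite <ᵇ-false {p0 + h} {s} (λ y → <-asym y (<-trans (n<1+n s) short))
        | ≡ᵇ-false {s} {p0 + h} (λ y → <-irrefl y (<-trans (n<1+n s) short))
        | ≡ᵇ-false {suc s} {p0 + h} (λ y → <-irrefl y short) | next with 1 ≤ᵇ h
... | true  = refl
... | false = refl

slide-stops : ∀ h hs p0 q → p0 ≤ q → hgt (slide (p0 + h) p0 (h ∷ hs)) p0 q ≡ hgt (h ∷ hs) p0 q + ind (q ≡ᵇ p0)
slide-stops h hs p0 q p0≤q rewrite <ᵇ-false (<-irrefl {p0 + h} refl) | ≡ᵇ-true {p0 + h} refl with q ≟ p0
... | yes refl rewrite n∸n≡0 q | ≡ᵇ-true {q} refl = +-comm 1 h
... | no ne rewrite ≡ᵇ-false ne | hgt-tail (suc h) hs p0 q (≤∧≢⇒< p0≤q (ne ∘ sym))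
                  | hgt-tail h hs p0 q (≤∧≢⇒< p0≤q (ne ∘ sym)) = sym (+-identityʳ _)

-- Past the end of the list all towers are empty, so the trajectory cannot move
-- and must already be at its target.
trajectory-flat : ∀ (σ : ℕ → ℕ) t d q → q + d ≡ t → (∀ r → q ≤ r → r < t → SlideStep (λ _ → 0) σ r) →
  σ t ≡ t → σ q ≡ t
trajectory-flat σ t zero q e steps σt rewrite +-identityʳ q | e = σt
trajectory-flat σ t (suc d) q e steps σt with steps q ≤-refl (subst (q <_) e (m<m+n q (s≤s z≤n)))
... | passes _ next = trans (sym next) σq+1
  where
  σq+1 : σ (suc q) ≡ t
  σq+1 = trajectory-flat σ t d (suc q) (trans (sym (+-suc q d)) e) (λ r le lt → steps r (≤-trans (n≤1+n q) le) lt) σt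
... | increments short next = ⊥-elim (<-asym (subst (_< q + 0) (trans (sym next) σq+1) short)
                                           (subst (q + 0 <_) e (+-monoʳ-< q (s≤s z≤n))))
  where
  σq+1 : σ (suc q) ≡ t
  σq+1 = trajectory-flat σ t d (suc q) (trans (sym (+-suc q d)) e) (λ r le lt → steps r (≤-trans (n≤1+n q) le) lt) σt

nthD-newTower : ∀ j k → nthD j (replicate k 0 ++ [ 1 ]) 0 ≡ ind (j ≡ᵇ k)
nthD-newTower zero    zero    = refl
nthD-newTower (suc j) zero    = refl
nthD-newTower zero    (suc k) = refl
nthD-newTower (suc j) (suc k) = nthD-newTower j k

∸-≡ᵇ : ∀ {q t p} → p ≤ q → p ≤ t → (q ∸ p ≡ᵇ t ∸ p) ≡ (q ≡ᵇ t)
∸-≡ᵇ {q} {t} {p} p≤q p≤t with q ≟ t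
... | yes refl = trans (≡ᵇ-true {q ∸ p} refl) (sym (≡ᵇ-true {q} refl))
... | no ne    = trans (≡ᵇ-false (λ e → ne (∸-cancelʳ-≡ p≤q p≤t e))) (sym (≡ᵇ-false ne))

slide-raises : ∀ T p0 s t (σ H : ℕ → ℕ) → (∀ q → p0 ≤ q → hgt T p0 q ≡ H q) → p0 ≤ t → σ p0 ≡ s →
  (∀ q → p0 ≤ q → q < t → SlideStep H σ q) → σ t ≡ t + H t →
  ∀ q → p0 ≤ q → hgt (slide s p0 T) p0 q ≡ hgt T p0 q + ind (q ≡ᵇ t)
slide-raises [] p0 s t σ H agree p0≤t σp0 steps σt q p0≤q =
  trans (nthD-newTower (q ∸ p0) (s ∸ p0)) (cong ind (trans (cong (λ z → q ∸ p0 ≡ᵇ z ∸ p0) s≡t) (∸-≡ᵇ p0≤q p0≤t)))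
  where
  empty : ∀ r → p0 ≤ r → H r ≡ 0
  empty r le = sym (agree r le)
  flat : ∀ r → p0 ≤ r → r < t → SlideStep (λ _ → 0) σ r
  flat r le lt with steps r le lt
  ... | passes past next       = passes (subst (λ z → r + z < σ r) (empty r le) past) next
  ... | increments short next = increments (subst (λ z → suc (σ r) < r + z) (empty r le) short) next
  s≡t : s ≡ t
  s≡t with m≤n⇒∃[o]m+o≡n p0≤t
  ... | d , e = trans (sym σp0) (trajectory-flat σ t d p0 e flat (trans σt (trans (cong (t +_) (empty t p0≤t)) (+-identityʳ t))))
slide-raises (h ∷ hs) p0 s t σ H agree p0≤t σp0 steps σt q p0≤q with p0 ≟ t
... | yes refl = subst (λ z → hgt (slide z p0 (h ∷ hs)) p0 q ≡ hgt (h ∷ hs) p0 q + ind (q ≡ᵇ p0))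
                       (sym (trans (sym σp0) (trans σt (cong (p0 +_) head))))
                       (slide-stops h hs p0 q p0≤q)
  where
  head : H p0 ≡ h
  head = trans (sym (agree p0 ≤-refl)) (hgt-head h hs p0)
... | no p0≢t
  rewrite slide-passes s p0 h hs (steps p0 ≤-refl (≤∧≢⇒< p0≤t p0≢t)) σp0 (trans (sym (agree p0 ≤-refl)) (hgt-head h hs p0))
  with q ≟ p0
...   | yes refl rewrite hgt-head h (slide (σ (suc q)) (suc q) hs) q | hgt-head h hs q
                       | ≡ᵇ-false {q} {t} p0≢t = sym (+-identityʳ h)
...   | no q≢p0 = later (≤∧≢⇒< p0≤q (λ e → q≢p0 (sym e)))
  where
  later : p0 < q → hgt (h ∷ slide (σ (suc p0)) (suc p0) hs) p0 q ≡ hgt (h ∷ hs) p0 q + ind (q ≡ᵇ t)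
  later p0<q rewrite hgt-tail h (slide (σ (suc p0)) (suc p0) hs) p0 q p0<q | hgt-tail h hs p0 q p0<q =
    slide-raises hs (suc p0) (σ (suc p0)) t σ H (λ r lt → trans (sym (hgt-tail h hs p0 r lt)) (agree r (<⇒≤ lt)))
      (≤∧≢⇒< p0≤t p0≢t) refl (λ r lt r<t → steps r (<⇒≤ lt) r<t) σt q p0<q

-- The statistic governing tower heights:  J f y = #{x < y | f x > f y}.
J : (ℕ → ℕ) → ℕ → ℕ
J f y = sum (λ x → ind (f y <ᵇ f x)) y

sum-two-points : ∀ (h : ℕ → ℕ) a b N → a ≢ b → a < N → b < N →
  sum h N ≡ h a + h b + sum (λ x → if x ≡ᵇ a then 0 else (if x ≡ᵇ b then 0 else h x)) N
sum-two-points h a b N a≢b a<N b<N =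
  trans (sum-cong N split)
        (trans (sum-+ _ _ N) (cong (_+ sum rest N)
               (trans (sum-+ _ _ N) (cong₂ _+_ (sum-point h a N a<N) (sum-point h b N b<N)))))
  where
  rest : ℕ → ℕ
  rest x = if x ≡ᵇ a then 0 else (if x ≡ᵇ b then 0 else h x)
  split : ∀ x → x < N → h x ≡ ((if x ≡ᵇ a then h x else 0) + (if x ≡ᵇ b then h x else 0)) + rest x
  split x _ with x ≟ a
  ... | yes refl rewrite ≡ᵇ-true {x} refl | ≡ᵇ-false a≢b = sym (trans (+-identityʳ _) (+-identityʳ _))
  ... | no x≢a rewrite ≡ᵇ-false x≢a with x ≟ b
  ...   | yes refl rewrite ≡ᵇ-true {x} refl = sym (+-identityʳ _)
  ...   | no x≢b rewrite ≡ᵇ-false x≢b = refl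

sum-transpose : ∀ (h : ℕ → ℕ) a b N → a ≢ b → a < N → b < N → sum (λ x → h (tr a b x)) N ≡ sum h N
sum-transpose h a b N a≢b a<N b<N =
  trans (sum-two-points (λ x → h (tr a b x)) a b N a≢b a<N b<N)
    (trans (cong₂ _+_ (trans (cong₂ _+_ (cong h (tr-a a b)) (cong h (tr-b a b))) (+-comm (h b) (h a))) (sum-cong N same))
      (sym (sum-two-points h a b N a≢b a<N b<N)))
  where
  same : ∀ x → x < N → (if x ≡ᵇ a then 0 else (if x ≡ᵇ b then 0 else h (tr a b x)))
                     ≡ (if x ≡ᵇ a then 0 else (if x ≡ᵇ b then 0 else h x))
  same x _ with x ≟ a
  ... | yes refl rewrite ≡ᵇ-true {x} refl = refl
  ... | no x≢a with x ≟ b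
  ...   | yes refl rewrite ≡ᵇ-false x≢a | ≡ᵇ-true {x} refl = refl
  ...   | no x≢b rewrite ≡ᵇ-false x≢a | ≡ᵇ-false x≢b = refl

module Counting (w : List ℕ) (B : Bijective w) where
  f g : ℕ → ℕ
  f = at w
  g = proj₁ B

  g∘f : ∀ x → g (f x) ≡ x
  g∘f = proj₁ (proj₂ B)

  f∘g : ∀ y → f (g y) ≡ y
  f∘g = proj₂ (proj₂ B)

  injective : ∀ {x y} → f x ≡ f y → x ≡ y
  injective = bij-injective B

  preimageBound : ℕ → ℕ
  preimageBound zero    = 0
  preimageBound (suc q) = preimageBound q ⊔ suc (g q)

  preimageBound-ok : ∀ q x → f x < q → x < preimageBound q
  preimageBound-ok (suc q) x lt with f x ≟ q
  ... | yes e = ≤-trans (s≤s (≤-reflexive (trans (sym (g∘f x)) (cong g e)))) (m≤n⊔m (preimageBound q) _)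
  ... | no ne = ≤-trans (preimageBound-ok q x (≤∧≢⇒< (≤-pred lt) ne)) (m≤m⊔n _ _)

  below-suc : ∀ q x → ind (f x <ᵇ suc q) ≡ ind (f x <ᵇ q) + ind (x ≡ᵇ g q)
  below-suc q x with x ≟ g q
  ... | yes refl rewrite f∘g q | <ᵇ-true (n<1+n q) | <ᵇ-false (<-irrefl {q} refl) | ≡ᵇ-true {g q} refl = refl
  ... | no ne rewrite ≡ᵇ-false ne with f x <? q
  ...   | yes lt rewrite <ᵇ-true lt | <ᵇ-true (m<n⇒m<1+n lt) = refl
  ...   | no nlt rewrite <ᵇ-false nlt
          | <ᵇ-false {f x} {suc q} (λ lt → nlt (≤∧≢⇒< (≤-pred lt) (λ e → ne (trans (sym (g∘f x)) (cong g e))))) = refl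

  count-below : ∀ q N → (∀ x → f x < q → x < N) → sum (λ x → ind (f x <ᵇ q)) N ≡ q
  count-below zero    N _     = sum-zero N (λ x _ → cong ind (<ᵇ-false {f x} {0} (λ ())))
  count-below (suc q) N bound = begin
    sum (λ x → ind (f x <ᵇ suc q)) N                        ≡⟨ sum-cong N (λ x _ → below-suc q x) ⟩
    sum (λ x → ind (f x <ᵇ q) + ind (x ≡ᵇ g q)) N           ≡⟨ sum-+ _ _ N ⟩
    sum (λ x → ind (f x <ᵇ q)) N + sum (λ x → ind (x ≡ᵇ g q)) N
      ≡⟨ cong₂ _+_ (count-below q N (λ x lt → bound x (m<n⇒m<1+n lt)))
                   (sum-point (λ _ → 1) (g q) N (bound (g q) (subst (_< suc q) (sym (f∘g q)) ≤-refl))) ⟩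
    q + 1                                                    ≡⟨ +-comm q 1 ⟩
    suc q                                                    ∎
    where open ≡-Reasoning

  -- Sliding the letter p into 𝒯 when p is an ascent of w: the trajectory of the
  -- slide is  σ q = p + C q,  C q = #{x > p | f x < q},  and it stops at tower f p.
  module AscentSlide (p : ℕ) (hp : 1 ≤ p) (asc : f p < f (suc p)) where
    t : ℕ
    t = f p

    N : ℕ
    N = preimageBound (suc t) ⊔ suc (suc p)

    inRange : ∀ x → f x < suc t → x < N
    inRange x lt = ≤-trans (preimageBound-ok (suc t) x lt) (m≤m⊔n _ _)

    p+1<N : suc p < N
    p+1<N = m≤n⊔m (preimageBound (suc t)) _

    p<N : p < N
    p<N = <-trans (n<1+n p) p+1<N

    C : ℕ → ℕ
    C q = sum (λ x → ind ((p <ᵇ x) ∧ (f x <ᵇ q))) N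

    C-suc : ∀ q → q < suc t → C (suc q) ≡ C q + ind (p <ᵇ g q)
    C-suc q lt = trans (sum-cong N step) (trans (sum-+ _ _ N)
      (cong (C q +_) (sum-point (λ x → ind (p <ᵇ x)) (g q) N (inRange (g q) (subst (_< suc t) (sym (f∘g q)) lt)))))
      where
      step : ∀ x → x < N → ind ((p <ᵇ x) ∧ (f x <ᵇ suc q))
                         ≡ ind ((p <ᵇ x) ∧ (f x <ᵇ q)) + (if x ≡ᵇ g q then ind (p <ᵇ x) else 0)
      step x _ = ind-∧ (p <ᵇ x) (f x <ᵇ suc q) (f x <ᵇ q) (x ≡ᵇ g q) (below-suc q x)

    C-one : C 1 ≡ 0
    C-one = trans (C-suc 0 (s≤s z≤n)) (trans (cong₂ _+_ C-zero (cong (λ z → ind (p <ᵇ z)) g0)) (cong ind (<ᵇ-false {p} {0} (λ ()))))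
      where
      C-zero : C 0 ≡ 0
      C-zero = sum-zero N (λ x _ → cong ind (trans (cong ((p <ᵇ x) ∧_) (<ᵇ-false {f x} {0} (λ ()))) (∧-zeroʳ _)))
      g0 : g 0 ≡ 0
      g0 = g∘f 0

    -- Summands whose totals are  f y + J f y  and  p + C v  respectively.
    leftTerm : ℕ → ℕ → ℕ
    leftTerm y x = ind (f x <ᵇ f y) + (if x <ᵇ y then ind (f y <ᵇ f x) else 0)

    rightTerm : ℕ → ℕ → ℕ
    rightTerm v x = ind (x <ᵇ p) + ind ((p <ᵇ x) ∧ (f x <ᵇ v))

    sum-leftTerm : ∀ y → f y < suc t → sum (leftTerm y) N ≡ f y + J f y
    sum-leftTerm y fy≤t = trans (sum-+ _ _ N) (cong₂ _+_
      (count-below (f y) N (λ x lt → inRange x (<-trans lt fy≤t)))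
      (sum-prefix (λ x → ind (f y <ᵇ f x)) y N (<⇒≤ (inRange y fy≤t))))

    sum-rightTerm : ∀ v → sum (rightTerm v) N ≡ p + C v
    sum-rightTerm v = trans (sum-+ _ _ N) (cong (_+ C v) (sum-below p N (<⇒≤ p<N)))

    sum-plus-point : ∀ y (h : ℕ → ℕ) → y < N → sum (λ x → ind (x ≡ᵇ y) + h x) N ≡ suc (sum h N)
    sum-plus-point y h y<N = trans (sum-+ _ h N) (cong (_+ sum h N) (sum-point (λ _ → 1) y N y<N))

    -- Towers of values f y < t with y < p are passed by.
    before-pointwise : ∀ y → y < p → f y < t → ∀ x → ind (x ≡ᵇ y) + leftTerm y x ≤ rightTerm (f y) x
    before-pointwise y y<p fy<t x with <-cmp x y
    ... | tri< x<y x≢y _ rewrite ≡ᵇ-false x≢y | <ᵇ-true x<y | <ᵇ-true (<-trans x<y y<p)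
                                | ind-trichotomy f injective x≢y = s≤s z≤n
    ... | tri≈ _ refl _ rewrite ≡ᵇ-true {x} refl | <ᵇ-false (<-irrefl {x} refl)
                              | <ᵇ-false (<-irrefl {f x} refl) | <ᵇ-true y<p = s≤s z≤n
    ... | tri> _ x≢y y<x rewrite ≡ᵇ-false x≢y | <ᵇ-false (<⇒≯ y<x) | +-identityʳ (ind (f x <ᵇ f y)) with <-cmp x p
    ...   | tri< x<p _ _ rewrite <ᵇ-true x<p = ≤-trans (ind≤1 _) (s≤s z≤n)
    ...   | tri≈ _ refl _ rewrite <ᵇ-false (<⇒≯ fy<t) = z≤n
    ...   | tri> _ _ p<x rewrite <ᵇ-false (<⇒≯ p<x) | <ᵇ-true p<x = ≤-refl

    passes-before : ∀ y → y < p → f y < t → suc (f y + J f y) ≤ p + C (f y)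
    passes-before y y<p fy<t = begin
      suc (f y + J f y)                            ≡⟨ cong suc (sym (sum-leftTerm y (m<n⇒m<1+n fy<t))) ⟩
      suc (sum (leftTerm y) N)                     ≡⟨ sym (sum-plus-point y (leftTerm y) (<-trans y<p p<N)) ⟩
      sum (λ x → ind (x ≡ᵇ y) + leftTerm y x) N    ≤⟨ sum-mono N (λ x _ → before-pointwise y y<p fy<t x) ⟩
      sum (rightTerm (f y)) N                      ≡⟨ sum-rightTerm (f y) ⟩
      p + C (f y)                                  ∎
      where open ≤-Reasoning

    -- Towers of values f y < t with y > p increment the slid value.
    not-p+1 : ∀ y → f y < t → y ≢ suc p
    not-p+1 y fy<t refl = <-asym fy<t asc

    after-pointwise : ∀ y → p < y → f y < t → ∀ x →
      ind (x ≡ᵇ p) + (ind (x ≡ᵇ suc p) + rightTerm (f y) x) ≤ leftTerm y x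
    after-pointwise y p<y fy<t x with <-cmp x p
    ... | tri< x<p x≢p _ rewrite ≡ᵇ-false x≢p | ≡ᵇ-false {x} {suc p} (λ e → <-irrefl e (<-trans x<p (n<1+n p)))
          | <ᵇ-true x<p | <ᵇ-false (<⇒≯ x<p) | <ᵇ-true (<-trans x<p p<y)
          | ind-trichotomy f {x} {y} injective (λ e → <-irrefl e (<-trans x<p p<y)) = ≤-refl
    ... | tri≈ _ refl _ rewrite ≡ᵇ-true {x} refl | ≡ᵇ-false {x} {suc x} (λ e → <-irrefl e (n<1+n x))
          | <ᵇ-false (<-irrefl {x} refl) | <ᵇ-true p<y | ind-trichotomy f {x} {y} injective (λ e → <-irrefl e p<y) = ≤-refl
    ... | tri> _ x≢p p<x rewrite ≡ᵇ-false x≢p | <ᵇ-false (<⇒≯ p<x) | <ᵇ-true p<x with <-cmp x (suc p)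
    ...   | tri< x<p+1 _ _ = ⊥-elim (<-irrefl refl (<-≤-trans x<p+1 p<x))
    ...   | tri≈ _ refl _ rewrite ≡ᵇ-true {suc p} refl | <ᵇ-true (≤∧≢⇒< p<y (λ e → not-p+1 y fy<t (sym e)))
            | ind-trichotomy f {suc p} {y} injective (λ e → not-p+1 y fy<t (sym e)) | <ᵇ-false (<⇒≯ (<-trans fy<t asc)) = ≤-refl
    ...   | tri> _ x≢p+1 _ rewrite ≡ᵇ-false x≢p+1 with <-cmp x y
    ...     | tri< x<y _ _ rewrite <ᵇ-true x<y | ind-trichotomy f {x} {y} injective (λ e → <-irrefl e x<y) = ind≤1 _
    ...     | tri≈ _ refl _ rewrite <ᵇ-false (<-irrefl {f x} refl) = z≤n
    ...     | tri> _ _ y<x rewrite <ᵇ-false (<⇒≯ y<x) = ≤-reflexive (sym (+-identityʳ _))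

    increments-after : ∀ y → p < y → f y < t → suc (suc (p + C (f y))) ≤ f y + J f y
    increments-after y p<y fy<t = begin
      suc (suc (p + C (f y)))
        ≡⟨ cong (suc ∘ suc) (sym (sum-rightTerm (f y))) ⟩
      suc (suc (sum (rightTerm (f y)) N))
        ≡⟨ cong suc (sym (sum-plus-point (suc p) (rightTerm (f y)) p+1<N)) ⟩
      suc (sum (λ x → ind (x ≡ᵇ suc p) + rightTerm (f y) x) N)
        ≡⟨ sym (sum-plus-point p _ p<N) ⟩
      sum (λ x → ind (x ≡ᵇ p) + (ind (x ≡ᵇ suc p) + rightTerm (f y) x)) N
        ≤⟨ sum-mono N (λ x _ → after-pointwise y p<y fy<t x) ⟩
      sum (leftTerm y) N
        ≡⟨ sum-leftTerm y (≤-trans (m<n⇒m<1+n fy<t) ≤-refl) ⟩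
      f y + J f y ∎
      where open ≤-Reasoning

    -- At tower t = f p the slid value reaches  t + J f p  and the slide stops.
    stops-at-t : p + C t ≡ t + J f p
    stops-at-t = begin
      p + C t                  ≡⟨ sym (sum-rightTerm t) ⟩
      sum (rightTerm t) N      ≡⟨ sum-cong N (λ x _ → pointwise x) ⟩
      sum (leftTerm p) N       ≡⟨ sum-leftTerm p (n<1+n t) ⟩
      t + J f p                ∎
      where
      open ≡-Reasoning
      pointwise : ∀ x → rightTerm t x ≡ leftTerm p x
      pointwise x with <-cmp x p
      ... | tri< x<p _ _ rewrite <ᵇ-true x<p | <ᵇ-false (<⇒≯ x<p)
                               | ind-trichotomy f {x} {p} injective (λ e → <-irrefl e x<p) = refl
      ... | tri≈ _ refl _ rewrite <ᵇ-false (<-irrefl {x} refl) | <ᵇ-false (<-irrefl {f x} refl) = refl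
      ... | tri> _ _ p<x rewrite <ᵇ-false (<⇒≯ p<x) | <ᵇ-true p<x = sym (+-identityʳ _)

    -- The trajectory of the slide; at tower q = f y it passes if y < p and
    -- increments if y > p (no tower q < t has y = p).
    σ : ℕ → ℕ
    σ q = p + C q

    trajectory : (T : List ℕ) → (∀ y → height T (f y) ≡ J f y) → ∀ q → 1 ≤ q → q < t → SlideStep (height T) σ q
    trajectory T tower q _ q<t with <-cmp (g q) p
    ... | tri< y<p _ _ = passes
          (subst₂ (λ u v → u + v < p + C u) (f∘g q) (sym heightq) (passes-before (g q) y<p fgq<t))
          (cong (p +_) (trans (C-suc q (m<n⇒m<1+n q<t)) (trans (cong (λ b → C q + ind b) (<ᵇ-false (<⇒≯ y<p))) (+-identityʳ _))))
      where
      fgq<t = subst (_< t) (sym (f∘g q)) q<t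
      heightq = trans (cong (height T) (sym (f∘g q))) (tower (g q))
    ... | tri≈ _ e _ = ⊥-elim (<-irrefl (trans (sym (f∘g q)) (cong f e)) q<t)
    ... | tri> _ _ p<y = increments
          (subst₂ (λ u v → suc (suc (p + C u)) ≤ u + v) (f∘g q) (sym heightq) (increments-after (g q) p<y fgq<t))
          (trans (cong (p +_) (trans (C-suc q (m<n⇒m<1+n q<t)) (cong (λ b → C q + ind b) (<ᵇ-true p<y))))
                 (trans (cong (p +_) (+-comm (C q) 1)) (+-suc p (C q))))
      where
      fgq<t = subst (_< t) (sym (f∘g q)) q<t
      heightq = trans (cong (height T) (sym (f∘g q))) (tower (g q))

    slide-ascent : (T : List ℕ) → (∀ y → height T (f y) ≡ J f y) →
      ∀ q → 1 ≤ q → height (slideIn T p) q ≡ height T q + ind (q ≡ᵇ t)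
    slide-ascent T tower (suc q) _ =
      slide-raises T 1 p t σ (height T) agree 1≤t (trans (cong (p +_) C-one) (+-identityʳ p))
        (trajectory T tower) (trans stops-at-t (cong (t +_) (sym (tower p)))) (suc q) (s≤s z≤n)
      where
      agree : ∀ r → 1 ≤ r → hgt T 1 r ≡ height T r
      agree (suc r) _ = refl
      1≤t : 1 ≤ t
      1≤t = bij-positive B p hp

firstDescent-just₂ : ∀ i x y r p → firstDescent i (x ∷ y ∷ r) ≡ just p →
  Σ ℕ λ j → (p ≡ i + j) × (suc j < length (x ∷ y ∷ r)) × (nthD (suc j) (x ∷ y ∷ r) 0 < nthD j (x ∷ y ∷ r) 0)
firstDescent-just₂ i x y r p e with y <ᵇ x | <ᵇ⇒< y x
firstDescent-just₂ i x y r p e | true | y<x =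
  0 , trans (sym (just-injective e)) (sym (+-identityʳ i)) , s≤s (s≤s z≤n) , y<x tt
  where
  just-injective : ∀ {a b : ℕ} → just a ≡ just b → a ≡ b
  just-injective refl = refl
firstDescent-just₂ i x y []      p () | false | _
firstDescent-just₂ i x y (z ∷ r) p e  | false | _ with firstDescent-just₂ (suc i) y z r p e
... | j , refl , lt , d = suc j , sym (+-suc i j) , s≤s lt , d

firstDescent-just : ∀ i w p → firstDescent i w ≡ just p →
  Σ ℕ λ j → (p ≡ i + j) × (suc j < length w) × (nthD (suc j) w 0 < nthD j w 0)
firstDescent-just i (x ∷ y ∷ r) p e = firstDescent-just₂ i x y r p e

firstDescent-nothing : ∀ i w → firstDescent i w ≡ nothing → ∀ j → suc j < length w → nthD j w 0 ≤ nthD (suc j) w 0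
firstDescent-nothing i (x ∷ []) e j (s≤s ())
firstDescent-nothing i (x ∷ y ∷ r) e j lt with y <ᵇ x in y<x
firstDescent-nothing i (x ∷ y ∷ r) () j       lt       | true
firstDescent-nothing i (x ∷ y ∷ r) e  zero    lt       | false = ≮⇒≥ (λ p → subst T y<x (<⇒<ᵇ p))
firstDescent-nothing i (x ∷ y ∷ r) e  (suc j) (s≤s lt) | false = firstDescent-nothing (suc i) (y ∷ r) e j lt

descent : ∀ w p → firstDescent 1 w ≡ just p → (1 ≤ p) × (suc p ≤ length w) × (at w (suc p) < at w p)
descent w p e with firstDescent-just 1 w p e
... | j , refl , lt , d =
  s≤s z≤n , lt , subst₂ _<_ (sym (at-nthD w (suc j) lt)) (sym (at-nthD w j (<-trans (n<1+n j) lt))) d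

increasing-step : ∀ w → Bijective w → firstDescent 1 w ≡ nothing → ∀ x → at w x ≤ at w (suc x)
increasing-step w B e zero = z≤n
increasing-step w B e (suc j) with suc j <? length w
... | yes lt = subst₂ _≤_ (sym (at-nthD w j (<-trans (n<1+n j) lt))) (sym (at-nthD w (suc j) lt))
                        (firstDescent-nothing 1 w e j lt)
... | no ¬lt with suc j ≟ length w
...   | yes eq rewrite at-beyond w (suc (suc j)) (s≤s (≤-reflexive (sym eq))) =
        ≤-trans (bij-range B (suc j) (≤-reflexive eq)) (≤-trans (≤-reflexive (sym eq)) (n≤1+n _))
...   | no ne = beyond (≤∧≢⇒< (≮⇒≥ ¬lt) (λ e' → ne (sym e')))
  where
  beyond : length w < suc j → at w (suc j) ≤ at w (suc (suc j))
  beyond n<sj rewrite at-beyond w (suc j) n<sj | at-beyond w (suc (suc j)) (<-trans n<sj (n<1+n _)) = n≤1+n _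

increasing : ∀ w → Bijective w → firstDescent 1 w ≡ nothing → ∀ x d → at w x ≤ at w (x + d)
increasing w B e x zero    rewrite +-identityʳ x = ≤-refl
increasing w B e x (suc d) rewrite +-suc x d = ≤-trans (increasing w B e x d) (increasing-step w B e (x + d))

J-increasing : ∀ w → Bijective w → firstDescent 1 w ≡ nothing → ∀ y → J (at w) y ≡ 0
J-increasing w B e y = sum-zero y vanish
  where
  vanish : ∀ x → x < y → ind (at w y <ᵇ at w x) ≡ 0
  vanish x lt with m≤n⇒∃[o]m+o≡n (<⇒≤ lt)
  ... | d , refl = cong ind (<ᵇ-false (≤⇒≯ (increasing w B e x d)))

module Transposed (f f' : ℕ → ℕ) (a b : ℕ) (a<b : a < b) (f'≡ : ∀ z → f' z ≡ f (tr a b z))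
                  (injective : ∀ {x y} → f x ≡ f y → x ≡ y) where

  f'-a : f' a ≡ f b
  f'-a = trans (f'≡ a) (cong f (tr-a a b))

  f'-b : f' b ≡ f a
  f'-b = trans (f'≡ b) (cong f (tr-b a b))

  f'-other : ∀ x → x ≢ a → x ≢ b → f' x ≡ f x
  f'-other x x≢a x≢b = trans (f'≡ x) (cong f (tr-other a b x x≢a x≢b))

  f'-before : ∀ x → x < a → f' x ≡ f x
  f'-before x x<a = f'-other x (λ e → <-irrefl e x<a) (λ e → <-irrefl e (<-trans x<a a<b))

  count-before : ∀ c y → y ≤ a → sum (λ x → ind (c <ᵇ f' x)) y ≡ sum (λ x → ind (c <ᵇ f x)) y
  count-before c y y≤a = sum-cong y (λ x x<y → cong (λ z → ind (c <ᵇ z)) (f'-before x (<-≤-trans x<y y≤a)))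

  -- Beyond b, J only sees the transposition as a reordering of its range.
  J-after : ∀ y → b < y → J f' y ≡ J f y
  J-after y b<y = begin
    sum (λ x → ind (f' y <ᵇ f' x)) y          ≡⟨ sum-cong y (λ x _ → cong₂ (λ u v → ind (u <ᵇ v)) f'y (f'≡ x)) ⟩
    sum (λ x → ind (f y <ᵇ f (tr a b x))) y   ≡⟨ sum-transpose (λ x → ind (f y <ᵇ f x)) a b y (<⇒≢ a<b) (<-trans a<b b<y) b<y ⟩
    sum (λ x → ind (f y <ᵇ f x)) y            ∎
    where
    open ≡-Reasoning
    f'y : f' y ≡ f y
    f'y = f'-other y (λ e → <-irrefl (sym e) (<-trans a<b b<y)) (λ e → <-irrefl (sym e) b<y)

module AdjacentDescent (f f' : ℕ → ℕ) (p : ℕ) (f'≡ : ∀ z → f' z ≡ f (tr p (suc p) z))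
                       (injective : ∀ {x y} → f x ≡ f y → x ≡ y) (desc : f (suc p) < f p) where
  open Transposed f f' p (suc p) (n<1+n p) f'≡ injective

  J-descent : ∀ y → J f' (tr p (suc p) y) + ind (f y ≡ᵇ f' p) ≡ J f y
  J-descent y with <-cmp y p
  ... | tri< y<p y≢p _
    rewrite tr-other p (suc p) y y≢p (λ e → <-irrefl e (<-trans y<p (n<1+n p))) | f'-a
          | ≡ᵇ-false {f y} {f (suc p)} (λ e → <-irrefl (injective e) (<-trans y<p (n<1+n p)))
          | f'-before y y<p = trans (+-identityʳ _) (count-before (f y) y (<⇒≤ y<p))
  ... | tri≈ _ refl _
    rewrite tr-a y (suc y) | f'-a | f'-b | ≡ᵇ-false {f y} {f (suc y)} (λ e → <-irrefl (injective e) (n<1+n y))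
          | <ᵇ-false (<⇒≯ desc) = trans (+-identityʳ _) (trans (+-identityʳ _) (count-before (f y) y ≤-refl))
  ... | tri> _ _ p<y with <-cmp y (suc p)
  ...   | tri< y<p+1 _ _ = ⊥-elim (<-irrefl refl (<-≤-trans y<p+1 p<y))
  ...   | tri≈ _ refl _ rewrite tr-b p y | f'-a | ≡ᵇ-true {f y} refl | <ᵇ-true desc =
          cong (_+ 1) (count-before (f y) p ≤-refl)
  ...   | tri> _ y≢p+1 p+1<y
    rewrite tr-other p (suc p) y (λ e → <-irrefl (sym e) p<y) y≢p+1 | f'-a
          | ≡ᵇ-false {f y} {f (suc p)} (λ e → y≢p+1 (injective e)) = trans (+-identityʳ _) (J-after y p+1<y)

tower-step : ∀ w p → Bijective w → 1 ≤ p → at w (suc p) < at w p → (T : List ℕ) →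
  (∀ y → height T (at (mulT w p (suc p)) y) ≡ J (at (mulT w p (suc p))) y) →
  ∀ y → height (slideIn T p) (at w y) ≡ J (at w) y
tower-step w p B hp desc T tower zero    = refl
tower-step w p B hp desc T tower (suc y) = begin
  height (slideIn T p) (f (suc y))                        ≡⟨ A.slide-ascent T tower (f (suc y)) (bij-positive B (suc y) (s≤s z≤n)) ⟩
  height T (f (suc y)) + ind (f (suc y) ≡ᵇ f' p)          ≡⟨ cong (λ z → height T z + ind (f (suc y) ≡ᵇ f' p)) (sym back) ⟩
  height T (f' (tr p (suc p) (suc y))) + ind (f (suc y) ≡ᵇ f' p)
                                                          ≡⟨ cong (_+ ind (f (suc y) ≡ᵇ f' p)) (tower (tr p (suc p) (suc y))) ⟩
  J f' (tr p (suc p) (suc y)) + ind (f (suc y) ≡ᵇ f' p)   ≡⟨ D.J-descent (suc y) ⟩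
  J f (suc y)                                             ∎
  where
  open ≡-Reasoning
  w' = mulT w p (suc p)
  f = at w
  f' = at w'
  B' : Bijective w'
  B' = bij-mulT p (suc p) hp (s≤s z≤n) B
  f'≡ : ∀ z → f' z ≡ f (tr p (suc p) z)
  f'≡ = at-mulT w p (suc p) hp (s≤s z≤n)
  ascent : f' p < f' (suc p)
  ascent = subst₂ _<_ (sym (trans (f'≡ p) (cong f (tr-a p (suc p)))))
                      (sym (trans (f'≡ (suc p)) (cong f (tr-b p (suc p))))) desc
  back : f' (tr p (suc p) (suc y)) ≡ f (suc y)
  back = trans (f'≡ (tr p (suc p) (suc y))) (cong f (tr-involutive p (suc p) (suc y)))
  module A = Counting.AscentSlide w' B' p hp ascent
  module D = AdjacentDescent f f' p f'≡ (bij-injective B) desc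

height-empty : ∀ q → height [] q ≡ 0
height-empty zero    = refl
height-empty (suc q) = refl

-- Induction along the canonical reduced word; the fuel ℓ(w) never runs out
-- because every step removes an inversion.
tower-formulaF : ∀ fuel w → Bijective w → len w ≤ fuel →
  ∀ y → height (towersOfWord (redWordF fuel w)) (at w y) ≡ J (at w) y
tower-formulaF zero w B len≤0 y with firstDescent 1 w in e
... | nothing = trans (height-empty (at w y)) (sym (J-increasing w B e y))
... | just p with descent w p e
...   | 1≤p , p+1≤n , desc = ⊥-elim (<⇒≱ (mulT-inversion-len w p (suc p) 1≤p (n<1+n p) p+1≤n desc) (≤-trans len≤0 z≤n))
tower-formulaF (suc fuel) w B len≤fuel y with firstDescent 1 w in e
... | nothing = trans (height-empty (at w y)) (sym (J-increasing w B e y))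
... | just p with descent w p e
...   | 1≤p , p+1≤n , desc rewrite foldl-++ slideIn [] (redWordF fuel (mulT w p (suc p))) [ p ] =
        tower-step w p B 1≤p desc _
          (tower-formulaF fuel (mulT w p (suc p)) (bij-mulT p (suc p) 1≤p (s≤s z≤n) B)
             (≤-pred (<-≤-trans (mulT-inversion-len w p (suc p) 1≤p (n<1+n p) p+1≤n desc) len≤fuel))) y

tower-formula : ∀ w → Bijective w → ∀ y → height (towerDiagram w) (at w y) ≡ J (at w) y
tower-formula w B = tower-formulaF (len w) w B ≤-refl

module BruhatCover (f f' : ℕ → ℕ) (a b : ℕ) (a<b : a < b) (f'≡ : ∀ z → f' z ≡ f (tr a b z))
                   (injective : ∀ {x y} → f x ≡ f y → x ≡ y) (ascent : f a < f b) where
  open Transposed f f' a b a<b f'≡ injective public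

  larger-before : ℕ → ℕ → ℕ
  larger-before v A = sum (λ x → ind (v <ᵇ f x)) A

  -- After the step, position a carries f b, with the same entries before it.
  J'-a : J f' a ≡ larger-before (f b) a
  J'-a = trans (cong (λ v → sum (λ x → ind (v <ᵇ f' x)) a) f'-a) (count-before (f b) a ≤-refl)

  J'-a≤J-b : J f' a ≤ J f b
  J'-a≤J-b = ≤-trans (≤-reflexive J'-a) (sum-mono-range (λ x → ind (f b <ᵇ f x)) a b (<⇒≤ a<b))

  -- Between a and b, moving the smaller value f a to position b can only add
  -- larger entries to the left; beyond b nothing changes.
  J-grows : ∀ y → a < y → y ≢ b → J f y ≤ J f' y
  J-grows y a<y y≢b with <-cmp y b
  ... | tri< y<b _ _ = subst (λ v → J f y ≤ sum (λ x → ind (v <ᵇ f' x)) y) (sym f'y) (sum-mono y more)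
    where
    f'y : f' y ≡ f y
    f'y = f'-other y (λ e → <-irrefl (sym e) a<y) y≢b
    more : ∀ x → x < y → ind (f y <ᵇ f x) ≤ ind (f y <ᵇ f' x)
    more x x<y with x ≟ a
    ... | yes refl rewrite f'-a = <ᵇ-monoʳ (f y) (<⇒≤ ascent)
    ... | no x≢a rewrite f'-other x x≢a (λ e → <-irrefl e (<-trans x<y y<b)) = ≤-refl
  ... | tri≈ _ y≡b _ = ⊥-elim (y≢b y≡b)
  ... | tri> _ _ b<y = ≤-reflexive (sym (J-after y b<y))

  J-cover : J f a + 1 + J f b ≤ J f' b + J f' a
  J-cover = begin
    J f a + 1 + J f b
      ≡⟨ cong₂ (λ u v → u + v + J f b) (sym (sum-prefix (λ x → ind (f a <ᵇ f x)) a b (<⇒≤ a<b)))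
                                         (sym (sum-point (λ _ → 1) a b a<b)) ⟩
    sum X b + sum E b + sum Y b            ≡⟨ cong (_+ sum Y b) (sym (sum-+ X E b)) ⟩
    sum (λ x → X x + E x) b + sum Y b      ≡⟨ sym (sum-+ _ Y b) ⟩
    sum (λ x → X x + E x + Y x) b          ≤⟨ sum-mono b (λ x _ → pointwise x) ⟩
    sum (λ x → Z x + W x) b                ≡⟨ sum-+ Z W b ⟩
    sum Z b + sum W b
      ≡⟨ cong₂ _+_ (cong (λ v → sum (λ x → ind (v <ᵇ f' x)) b) (sym f'-b))
                   (trans (sum-prefix (λ x → ind (f b <ᵇ f x)) a b (<⇒≤ a<b)) (sym J'-a)) ⟩
    J f' b + J f' a                        ∎
    where
    open ≤-Reasoning
    X E Y Z W : ℕ → ℕ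
    X x = if x <ᵇ a then ind (f a <ᵇ f x) else 0
    E x = ind (x ≡ᵇ a)
    Y x = ind (f b <ᵇ f x)
    Z x = ind (f a <ᵇ f' x)
    W x = if x <ᵇ a then ind (f b <ᵇ f x) else 0
    pointwise : ∀ x → X x + E x + Y x ≤ Z x + W x
    pointwise x with <-cmp x a
    ... | tri< x<a x≢a _ rewrite <ᵇ-true x<a | ≡ᵇ-false x≢a | f'-before x x<a =
          ≤-reflexive (cong (_+ ind (f b <ᵇ f x)) (+-identityʳ _))
    ... | tri≈ _ refl _ rewrite <ᵇ-false (<-irrefl {x} refl) | ≡ᵇ-true {x} refl | f'-a
          | <ᵇ-true ascent | <ᵇ-false (<⇒≯ ascent) = ≤-refl
    ... | tri> _ x≢a a<x rewrite <ᵇ-false (<⇒≯ a<x) | ≡ᵇ-false x≢a with x ≟ b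
    ...   | yes refl rewrite f'-b | <ᵇ-false (<-irrefl {f x} refl) = z≤n
    ...   | no x≢b rewrite f'-other x x≢a x≢b with f b <? f x
    ...     | yes fb<fx rewrite <ᵇ-true fb<fx | <ᵇ-true (<-trans ascent fb<fx) = ≤-refl
    ...     | no ¬fb<fx rewrite <ᵇ-false ¬fb<fx = z≤n

  -- The new cell (q , a , b) is placed strictly below the height J f' b.
  J-a<J'-b : J f a < J f' b
  J-a<J'-b = +-cancelʳ-≤ (J f b) (suc (J f a)) (J f' b) (begin
    suc (J f a) + J f b   ≡⟨ cong (_+ J f b) (+-comm 1 (J f a)) ⟩
    J f a + 1 + J f b     ≤⟨ J-cover ⟩
    J f' b + J f' a       ≤⟨ +-monoʳ-≤ (J f' b) J'-a≤J-b ⟩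
    J f' b + J f b        ∎)
    where open ≤-Reasoning

bOf : LCell → ℕ
bOf lc = proj₂ (proj₂ (proj₁ lc))

column : LCell → ℕ
column lc = proj₁ (proj₂ lc)

row : LCell → ℕ
row lc = proj₂ (proj₂ lc)

stepCells : ℕ → List ℕ → ℕ → ℕ → List LCell → List LCell
stepCells q w a b cells =
  map (λ lc → proj₁ lc , moveCell (towerDiagram w) (at w a) (at w b)
        (height (towerDiagram w) (at w b) ∸ height (towerDiagram (mulT w a b)) (at w b)) (proj₂ lc)) cells
  ++ [ ((q , a , b) , (at w a , height (towerDiagram w) (at w a))) ]

moveCell-other : ∀ D s l r x y → x ≢ l → moveCell D s l r (x , y) ≡ (x , y)
moveCell-other D s l r x y x≢l rewrite ≡ᵇ-false x≢l = refl

moveCell-lowered : ∀ D s l r y → height D l ∸ r ≤ y → y < height D l →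
  moveCell D s l r (l , y) ≡ (s , height D s + 1 + (y ∸ (height D l ∸ r)))
moveCell-lowered D s l r y start≤y y<top rewrite ≡ᵇ-true {l} refl | ≤ᵇ-true start≤y | <ᵇ-true y<top = refl

-- The invariant of a labelled cell with b-value b' once the chain has reached
-- the permutation w with last a-value A:  it lies in tower w(b'), its row is
-- below J_w(b') and at least #{x < A | w(x) > w(b')}, and b' > k.
Placed : List ℕ → ℕ → ℕ → LCell → Set
Placed w A k lc = (column lc ≡ at w (bOf lc)) × (row lc < J (at w) (bOf lc))
                × (sum (λ x → ind (at w (bOf lc) <ᵇ at w x)) A ≤ row lc) × (k < bOf lc)

carried-row-bound : ∀ u y j top J' → j ≤ y → y < top → u + top ≤ J' + j → u + (y ∸ j) < J'
carried-row-bound u y j top J' j≤y y<top budget = begin-strict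
  u + (y ∸ j)    <⟨ +-monoʳ-< u (∸-monoˡ-< y<top j≤y) ⟩
  u + (top ∸ j)  ≡⟨ sym (+-∸-assoc u (≤-trans j≤y (<⇒≤ y<top))) ⟩
  u + top ∸ j    ≤⟨ ∸-monoˡ-≤ j budget ⟩
  J' + j ∸ j     ≡⟨ m+n∸n≡m J' j ⟩
  J'             ∎
  where open ≤-Reasoning

module ChainStep (k q : ℕ) (w : List ℕ) (B : Bijective w) (A a b : ℕ) (1≤a : 1 ≤ a) (a≤k : a ≤ k) (k<b : k < b)
                 (ascent : at w a < at w b) (a≤A : a ≤ A) where
  f f' : ℕ → ℕ
  f = at w
  f' = at (mulT w a b)

  a<b : a < b
  a<b = <-≤-trans (s≤s a≤k) k<b

  B' : Bijective (mulT w a b)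
  B' = bij-mulT a b 1≤a (≤-trans 1≤a (<⇒≤ a<b)) B

  open BruhatCover f f' a b a<b (at-mulT w a b 1≤a (≤-trans 1≤a (<⇒≤ a<b))) (bij-injective B) ascent

  D D' : List ℕ
  D = towerDiagram w
  D' = towerDiagram (mulT w a b)

  height-s : height D (f a) ≡ J f a
  height-s = tower-formula w B a
  height-l : height D (f b) ≡ J f b
  height-l = tower-formula w B b
  height-l' : height D' (f b) ≡ J f' a
  height-l' = trans (cong (height D') (sym f'-a)) (tower-formula (mulT w a b) B' a)

  lowered-from : height D (f b) ∸ (height D (f b) ∸ height D' (f b)) ≡ J f' a
  lowered-from rewrite height-l | height-l' = m∸[m∸n]≡n J'-a≤J-b

  lower-bound-other : ∀ b' → b' ≢ a → b' ≢ b → sum (λ x → ind (f' b' <ᵇ f' x)) a ≤ sum (λ x → ind (f b' <ᵇ f x)) A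
  lower-bound-other b' b'≢a b'≢b = ≤-trans
    (≤-reflexive (trans (count-before (f' b') a ≤-refl) (cong (λ v → larger-before v a) (f'-other b' b'≢a b'≢b))))
    (sum-mono-range _ a A a≤A)

  lower-bound-b : sum (λ x → ind (f' b <ᵇ f' x)) a ≡ J f a
  lower-bound-b = trans (count-before (f' b) a ≤-refl) (cong (λ v → larger-before v a) f'-b)

  r : ℕ
  r = height D (f b) ∸ height D' (f b)

  -- A cell in tower f b above the invariant's lower bound is among the lowered ones.
  above-lowered : ∀ y → larger-before (f b) A ≤ y → J f' a ≤ y
  above-lowered y low≤y = ≤-trans (≤-reflexive J'-a) (≤-trans (sum-mono-range _ a A a≤A) low≤y)

  -- The cell labelled b sits in the lowered tower f b above row J f' a, so it is
  -- carried to tower f a = f' b.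
  moved-cell : ∀ lab y → bOf (lab , (f b , y)) ≡ b → Placed w A k (lab , (f b , y)) →
    Placed (mulT w a b) a k (lab , moveCell D (f a) (f b) r (f b , y))
  moved-cell lab y refl (_ , y<J , low≤y , k<b')
    rewrite moveCell-lowered D (f a) (f b) r y (subst (_≤ y) (sym lowered-from) (above-lowered y low≤y))
                                             (subst (y <_) (sym height-l) y<J)
          | lowered-from | height-s =
    sym f'-b ,
    carried-row-bound (J f a + 1) y (J f' a) (J f b) (J f' b) (above-lowered y low≤y) y<J J-cover ,
    ≤-trans (≤-reflexive lower-bound-b) (≤-trans (m≤m+n (J f a) 1) (m≤m+n _ _)) ,
    k<b'

  kept-cell : ∀ lab x y → bOf (lab , (x , y)) ≢ b → Placed w A k (lab , (x , y)) →
    Placed (mulT w a b) a k (lab , moveCell D (f a) (f b) r (x , y))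
  kept-cell lab x y b'≢b (refl , y<J , low≤y , k<b')
    rewrite moveCell-other D (f a) (f b) r (f (bOf (lab , (x , y)))) y (b'≢b ∘ bij-injective B) =
    sym (f'-other b' b'≢a b'≢b) , <-≤-trans y<J (J-grows b' a<b' b'≢b) , ≤-trans (lower-bound-other b' b'≢a b'≢b) low≤y , k<b'
    where
    b' = bOf (lab , (x , y))
    a<b' : a < b'
    a<b' = <-≤-trans (s≤s a≤k) k<b'
    b'≢a : b' ≢ a
    b'≢a e = <-irrefl (sym e) a<b'

  old-cell : ∀ lc → Placed w A k lc → Placed (mulT w a b) a k (proj₁ lc , moveCell D (f a) (f b) r (proj₂ lc))
  old-cell ((q' , a' , b') , (x , y)) placed with b' ≟ b
  ... | no b'≢b  = kept-cell (q' , a' , b') x y b'≢b placed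
  ... | yes refl with placed
  ...   | refl , bounds = moved-cell (q' , a' , b) y refl (refl , bounds)

  new-cell : Placed (mulT w a b) a k ((q , a , b) , (f a , height D (f a)))
  new-cell rewrite height-s = sym f'-b , J-a<J'-b , ≤-reflexive lower-bound-b , k<b

  step-placed : ∀ cells → All (Placed w A k) cells → All (Placed (mulT w a b) a k) (stepCells q w a b cells)
  step-placed cells placed = All.++⁺ (All.map⁺ (All.map (λ {lc} → old-cell lc) placed)) (new-cell ∷ [])

Outcome : List ℕ × List LCell → List LCell → List (ℕ × ℕ) → Set
Outcome result cells₀ c =
  Bijective (proj₁ result) × All (λ lc → column lc ≡ at (proj₁ result) (bOf lc)) (proj₂ result)
  × (map bOf (proj₂ result) ≡ map bOf cells₀ ++ map proj₂ c)

chain-invariant : ∀ k c q w A cells → Bijective w → KBruhatChain k w c → Linked _≥_ (A ∷ map proj₁ c) →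
  All (Placed w A k) cells → Outcome (buildLabels q w cells c) cells c
chain-invariant k [] q w A cells B _ _ placed = B , All.map proj₁ placed , sym (++-identityʳ _)
chain-invariant k ((a , b) ∷ c) q w A cells B (1≤a , a≤k , k<b , longer , chain) (a≤A ∷ decreasing) placed
  with chain-invariant k c (suc q) (mulT w a b) a (stepCells q w a b cells) S.B' chain decreasing (S.step-placed cells placed)
  where
  module S = ChainStep k q w B A a b 1≤a a≤k k<b
               (bruhat-ascent a b B 1≤a (<-≤-trans (s≤s a≤k) k<b) longer) a≤A
... | B∞ , columns , bs = B∞ , columns , (begin
  map bOf (proj₂ (buildLabels (suc q) (mulT w a b) (stepCells q w a b cells) c))
    ≡⟨ bs ⟩
  map bOf (stepCells q w a b cells) ++ map proj₂ c
    ≡⟨ cong (_++ map proj₂ c) (trans (map-++ bOf _ [ _ ]) (cong (_++ [ b ]) (sym (map-∘ cells)))) ⟩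
  (map bOf cells ++ [ b ]) ++ map proj₂ c
    ≡⟨ ++-assoc (map bOf cells) [ b ] (map proj₂ c) ⟩
  map bOf cells ++ b ∷ map proj₂ c ∎)
  where open ≡-Reasoning

first-a : List (ℕ × ℕ) → ℕ
first-a []            = 0
first-a ((a , _) ∷ _) = a

decreasing-from-first : ∀ c → Linked _≥_ (map proj₁ c) → Linked _≥_ (first-a c ∷ map proj₁ c)
decreasing-from-first []            _ = [-]
decreasing-from-first ((a , _) ∷ _) l = ≤-refl ∷ l

lemma6p6 : (ω : List ℕ) → IsPerm ω → (k m : ℕ) → 1 ≤ k → 1 ≤ m →
    (c : List (ℕ × ℕ)) → KBruhatChain k ω c → length c ≡ m →
    Linked _≥_ (map proj₁ c) →
    (Unique (map proj₂ c)
    ⇔ Unique (map (λ lc → proj₁ (proj₂ lc)) (proj₂ (labelledDiagram ω c))))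
lemma6p6 ω isPerm k m _ _ c chain _ decreasing =
  mk⇔ (λ distinct-b → subst Unique (sym towers) (Unique.map⁺ (bij-injective B∞) distinct-b))
      (λ distinct-towers → Unique.map⁻ (subst Unique towers distinct-towers))
  where
  result = buildLabels 1 ω [] c
  invariant : Outcome result [] c
  invariant = chain-invariant k c 1 ω (first-a c) [] (isPerm-bijective ω isPerm) chain
                (decreasing-from-first c decreasing) []
  B∞ = proj₁ invariant
  towers : map column (proj₂ result) ≡ map (at (proj₁ result)) (map proj₂ c)
  towers = trans (map-cong-local (proj₁ (proj₂ invariant)))
                 (trans (map-∘ (proj₂ result)) (cong (map (at (proj₁ result))) (proj₂ (proj₂ invariant))))
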